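{- Let $n\ge 4$ and let $R$ be a fixed coefficient ring. Let $t\in F$ and choose $\ell\in M(t)$. Suppose that for every $i\in M(t)\setminus\{\ell\}$ the word $s=\sigma_i(t)$ has a subword $t'\in F_{\mathrm{red}}$ (i.e. $t'\preceq s$ with $t'\in F_{\mathrm{red}}$). Then $t\in F_{\mathrm{red}}$.
   Context: Injective words in the alphabet $[n]=\{1,\dots,n\}$ are sequences of distinct letters; $\preceq$ is the subword (subsequence) relation. $S$ is the set of injective words of length $n$ (identified with $\Sigma_n$ via $\sigma\mapsto[\sigma(1)\cdots\sigma(n)]$), and $P=\{[s_1\cdots s_n]\in S: s_k=k \text{ for some } k\}$. $F$ is the set of all injective words of length $n-1$ in $[n]$; for $t\in F$ missing the letter $k$, and $1\le i\le n$, $\sigma_i(t)=[t_1\cdots t_{i-1}\,k\,t_i\cdots t_{n-1}]\in S$ (insert $k$ at position $i$). $M(t)=\{1\le i\le n:\sigma_i(t)\in P\}$. Let $C_{n-1}=R[P]$ and $C_{n-2}=R[F]$, with differential $d(\sum_{s\in P}\alpha_s s)=\sum_{t\in F}\beta_t t$, where $\beta_t=\sum_{i\in M(t)}(-1)^{i-1}\alpha_{\sigma_i(t)}$; let $Z_{n-1}$ be the kernel of $d$ (the top-dimensional cellular cycles of the complex of injective words generated by $P$ with coefficients in $R$). An element $s\in P$ is homologically redundant if $\alpha_s=0$ for every $\alpha=\sum\alpha_s s\in Z_{n-1}$. $F_{\mathrm{red}}=\{t\in F:\text{every } s\in P \text{ with } t\preceq s \text{ is homologically redundant}\}$. -}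

module Defs where

open import Level using (Level)
open import Data.Nat using (ℕ; zero; suc)
open import Data.Fin using (Fin; toℕ)
open import Data.Fin.Properties using (any?) renaming (_≟_ to _≟F_)
open import Data.Vec using (Vec; lookup; insertAt; toList)
open import Data.Vec.Relation.Unary.Unique.Propositional using (Unique)
open import Data.List using (List; filter; _∷_; []) renaming (allFin to allFinL)
open import Data.List.Relation.Binary.Sublist.Propositional using (_⊆_)
open import Data.Product using (Σ; ∃; _×_; _,_)
open import Relation.Binary.PropositionalEquality using (_≡_; _≢_)
open import Relation.Nullary using (¬_; Dec; yes; no; ¬?)
open import Algebra.Bundles using (Ring)
import Algebra.Properties.Monoid.Sum as MonoidSum

-- Throughout, the alphabet is [n] = Fin n with n = suc m, so that words of
-- length n-1 are vectors of length m.  Positions 1..n are Fin n (0-based).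

Injective : ∀ {n k} → Vec (Fin n) k → Set
Injective w = Unique w

InS : ∀ {n} → Vec (Fin n) n → Set
InS s = Injective s

InP : ∀ {n} → Vec (Fin n) n → Set
InP s = InS s × ∃ λ k → lookup s k ≡ k

InF : ∀ {m} → Vec (Fin (suc m)) m → Set
InF t = Injective t

_⪯_ : ∀ {n k l} → Vec (Fin n) k → Vec (Fin n) l → Set
u ⪯ w = toList u ⊆ toList w

-- the letter of [n] missing from t (the first letter not occurring in t;
-- for t ∈ F it is the unique missing letter)
missing : ∀ {m} → Vec (Fin (suc m)) m → Fin (suc m)
missing {m} t with filter (λ k → ¬? (any? (λ j → lookup t j ≟F k))) (allFinL (suc m))
... | k ∷ _ = k
... | [] = Data.Fin.zero

σ : ∀ {m} → Fin (suc m) → Vec (Fin (suc m)) m → Vec (Fin (suc m)) (suc m)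
σ i t = insertAt t i (missing t)

hasFixed? : ∀ {n} (s : Vec (Fin n) n) → Dec (∃ λ k → lookup s k ≡ k)
hasFixed? s = any? (λ k → lookup s k ≟F k)

InM : ∀ {m} → Vec (Fin (suc m)) m → Fin (suc m) → Set
InM t i = InP (σ i t)

module _ {c ℓ : Level} (R : Ring c ℓ) where
  open Ring R
  open MonoidSum +-monoid using (sum)

  sgn : ℕ → Carrier
  sgn zero = 1#
  sgn (suc k) = - sgn k

  -- an element of C_{n-1} = R[P]: coefficients on words of length n,
  -- vanishing outside P
  Chain : ℕ → Set c
  Chain n = Vec (Fin n) n → Carrier

  SupportedOnP : ∀ {n} → Chain n → Set ℓ
  SupportedOnP {n} α = ∀ s → ¬ InP s → α s ≈ 0#

  -- summand for position i: only i ∈ M(t) contribute  ((-1)^(i-1) with 1-based i)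
  term : ∀ {m} → Chain (suc m) → Vec (Fin (suc m)) m → Fin (suc m) → Carrier
  term α t i with hasFixed? (σ i t)
  ... | yes _ = sgn (toℕ i) * α (σ i t)
  ... | no _ = 0#

  d : ∀ {m} → Chain (suc m) → Vec (Fin (suc m)) m → Carrier
  d α t = sum (term α t)

  IsCycle : ∀ {m} → Chain (suc m) → Set ℓ
  IsCycle {m} α = SupportedOnP α × (∀ (t : Vec (Fin (suc m)) m) → InF t → d α t ≈ 0#)

  HomRedundant : ∀ {m} → Vec (Fin (suc m)) (suc m) → Set (c Level.⊔ ℓ)
  HomRedundant {m} s = InP s × (∀ (α : Chain (suc m)) → IsCycle α → α s ≈ 0#)

  InFred : ∀ {m} → Vec (Fin (suc m)) m → Set (c Level.⊔ ℓ)
  InFred {m} t = InF t × (∀ (s : Vec (Fin (suc m)) (suc m)) → InP s → t ⪯ s → HomRedundant s)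

-- The words of P containing t are exactly the σ_i(t), as a word of length n
-- containing t is t with one letter inserted, and injectivity forces that letter
-- to be the missing one.  For a cycle α, every σ_i(t) with i ≠ ℓ is outside P or
-- contains a word of F_red, so α vanishes there; the coefficient of t in dα = 0
-- then reduces to the single term ±α(σ_ℓ(t)), so α vanishes at σ_ℓ(t) as well.
module Submission where

open import Defs
open import Level using (Level)
open import Data.Nat using (ℕ; zero; suc; _≤_)
open import Data.Nat.Properties using (1+n≰n)
open import Data.Fin using (Fin; toℕ; punchIn; punchOut) renaming (zero to fzero; suc to fsuc)
open import Data.Fin.Properties using (any?; punchInᵢ≢i; punchIn-punchOut; punchOut-injective; injective⇒≤)
  renaming (_≟_ to _≟F_)
open import Data.Vec using (Vec; []; _∷_; lookup; insertAt; toList)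
open import Data.Vec.Properties using (insertAt-lookup; insertAt-punchIn; length-toList; toList-injective; cast-is-id)
open import Data.Vec.Functional using (replicate)
open import Data.Vec.Relation.Unary.Unique.Propositional using (Unique)
open import Data.Vec.Relation.Unary.Unique.Propositional.Properties using (lookup-injective)
open import Data.Vec.Relation.Unary.AllPairs using (allPairs?)
open import Data.List using (filter) renaming (allFin to allFinL; _∷_ to _∷ₗ_; [] to []ₗ)
open import Data.List.Relation.Unary.All using () renaming (_∷_ to _∷ₐ_)
open import Data.List.Relation.Unary.All.Properties using (all-filter)
open import Data.List.Membership.Propositional using (_∈_)
open import Data.List.Membership.Propositional.Properties using (∈-filter⁺; ∈-allFin)
open import Data.List.Relation.Binary.Sublist.Propositional using (_⊆_; _∷_; _∷ʳ_)
open import Data.List.Relation.Binary.Sublist.Heterogeneous.Properties using (toPointwise)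
open import Data.List.Relation.Binary.Pointwise using (Pointwise-≡⇒≡)
open import Data.Product using (∃; _×_; _,_; proj₁; proj₂)
open import Data.Empty using (⊥-elim)
open import Relation.Binary.PropositionalEquality using (_≡_; _≢_; refl; sym; trans; cong; cong₂; subst)
open import Relation.Nullary using (¬_; Dec; yes; no; ¬?; _×-dec_)
open import Algebra.Bundles using (Ring)
import Algebra.Properties.Ring as RingProperties
import Algebra.Properties.CommutativeMonoid.Sum as CommutativeMonoidSum
import Relation.Binary.Reasoning.Setoid as SetoidReasoning

_∉_ : ∀ {A : Set} {k} → A → Vec A k → Set
x ∉ w = ∀ j → lookup w j ≢ x

module _ {m} (t : Vec (Fin (suc m)) m) where
  private
    absent? : ∀ k → Dec (¬ ∃ λ j → lookup t j ≡ k)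
    absent? k = ¬? (any? (λ j → lookup t j ≟F k))

  missing-∉ : ∀ {x} → x ∉ t → missing t ∉ t
  missing-∉ {x} x∉t with filter absent? (allFinL (suc m)) in eq | all-filter absent? (allFinL (suc m))
  ... | k ∷ₗ _ | k∉t ∷ₐ _ = λ j e → k∉t (j , e)
  ... | []ₗ    | _ with () ← subst (x ∈_) eq (∈-filter⁺ absent? (∈-allFin x) λ (j , e) → x∉t j e)

unique⇒surjective : ∀ {n} {s : Vec (Fin n) n} → Unique s → ∀ k → ∃ λ p → lookup s p ≡ k
unique⇒surjective {suc n} {s} s! k with any? (λ p → lookup s p ≟F k)
... | yes hit = hit
... | no miss = ⊥-elim (1+n≰n (injective⇒≤ {f = λ p → punchOut (k≢s p)} injective))
  where
  k≢s : ∀ p → k ≢ lookup s p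
  k≢s p e = miss (p , sym e)
  injective : ∀ {p q} → punchOut (k≢s p) ≡ punchOut (k≢s q) → p ≡ q
  injective {p} {q} e = lookup-injective s! p q (punchOut-injective (k≢s p) (k≢s q) e)

module _ {A : Set} {m} (t : Vec A m) (i : Fin (suc m)) (x : A) where

  lookup-insertAt-≢ : ∀ {p} (i≢p : i ≢ p) → lookup (insertAt t i x) p ≡ lookup t (punchOut i≢p)
  lookup-insertAt-≢ i≢p = trans (cong (lookup (insertAt t i x)) (sym (punchIn-punchOut i≢p)))
                                (insertAt-punchIn t i x (punchOut i≢p))

  unique-insertAt⇒∉ : Unique (insertAt t i x) → x ∉ t
  unique-insertAt⇒∉ s! j e = punchInᵢ≢i i j (lookup-injective s! (punchIn i j) i
    (trans (insertAt-punchIn t i x j) (trans e (sym (insertAt-lookup t i x)))))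

unique-insertAt⇒≡missing : ∀ {m} (t : Vec (Fin (suc m)) m) i x → Unique (insertAt t i x) → x ≡ missing t
unique-insertAt⇒≡missing t i x s! with unique⇒surjective s! (missing t)
... | p , s[p]≡k with i ≟F p
...   | yes refl = trans (sym (insertAt-lookup t i x)) s[p]≡k
...   | no i≢p = ⊥-elim (missing-∉ t (unique-insertAt⇒∉ t i x s!) (punchOut i≢p)
                           (trans (sym (lookup-insertAt-≢ t i x i≢p)) s[p]≡k))

⊆-length-≡⇒≡ : ∀ {A : Set} {k} (u w : Vec A k) → toList u ⊆ toList w → u ≡ w
⊆-length-≡⇒≡ u w u⊆w = trans (sym (cast-is-id refl u)) (toList-injective refl u w
  (Pointwise-≡⇒≡ (toPointwise (trans (length-toList u) (sym (length-toList w))) u⊆w)))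

⊆-suc⇒insertAt : ∀ {A : Set} {m} (t : Vec A m) (s : Vec A (suc m)) → toList t ⊆ toList s →
  ∃ λ i → ∃ λ x → s ≡ insertAt t i x
⊆-suc⇒insertAt [] (b ∷ []) _ = fzero , b , refl
⊆-suc⇒insertAt (a ∷ t) (b ∷ s) (_ ∷ʳ t⊆s) = fzero , b , cong (b ∷_) (sym (⊆-length-≡⇒≡ (a ∷ t) s t⊆s))
⊆-suc⇒insertAt (a ∷ t) (b ∷ s) (a≡b ∷ t⊆s) with i , x , eq ← ⊆-suc⇒insertAt t s t⊆s
  = fsuc i , x , cong₂ _∷_ (sym a≡b) eq

⪯⇒≡σ : ∀ {m} (t : Vec (Fin (suc m)) m) (s : Vec (Fin (suc m)) (suc m)) → InS s → t ⪯ s →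
  ∃ λ i → s ≡ σ i t
⪯⇒≡σ t s s! t⪯s with i , x , refl ← ⊆-suc⇒insertAt t s t⪯s
  = i , cong (insertAt t i) (unique-insertAt⇒≡missing t i x s!)

InP? : ∀ {n} (s : Vec (Fin n) n) → Dec (InP s)
InP? s = allPairs? (λ a b → ¬? (a ≟F b)) s ×-dec hasFixed? s

module _ {c ℓ : Level} (R : Ring c ℓ) where
  open Ring R renaming (refl to ≈-refl; sym to ≈-sym; trans to ≈-trans)
  open RingProperties R using (-‿distribˡ-*; -‿distribʳ-*; -‿involutive)
  open CommutativeMonoidSum +-commutativeMonoid using (sum; sum-remove; sum-cong-≋; sum-replicate-zero)
  open SetoidReasoning setoid

  sgn*sgn≈1 : ∀ k → sgn R k * sgn R k ≈ 1#
  sgn*sgn≈1 zero = *-identityˡ 1#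
  sgn*sgn≈1 (suc k) = begin
    - sgn R k * - sgn R k   ≈⟨ ≈-sym (-‿distribˡ-* _ _) ⟩
    - (sgn R k * - sgn R k) ≈⟨ -‿cong (≈-sym (-‿distribʳ-* _ _)) ⟩
    - - (sgn R k * sgn R k) ≈⟨ -‿involutive _ ⟩
    sgn R k * sgn R k       ≈⟨ sgn*sgn≈1 k ⟩
    1#                      ∎

  sgn*x≈0⇒x≈0 : ∀ k {x} → sgn R k * x ≈ 0# → x ≈ 0#
  sgn*x≈0⇒x≈0 k {x} ±x≈0 = begin
    x                         ≈⟨ ≈-sym (*-identityˡ x) ⟩
    1# * x                    ≈⟨ *-congʳ (≈-sym (sgn*sgn≈1 k)) ⟩
    (sgn R k * sgn R k) * x   ≈⟨ *-assoc _ _ _ ⟩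
    sgn R k * (sgn R k * x)   ≈⟨ *-congˡ ±x≈0 ⟩
    sgn R k * 0#              ≈⟨ zeroʳ _ ⟩
    0#                        ∎

  sum-single : ∀ {n} (f : Fin (suc n) → Carrier) l → (∀ j → j ≢ l → f j ≈ 0#) → sum f ≈ f l
  sum-single {n} f l f≈0 = begin
    sum f                              ≈⟨ sum-remove f ⟩
    f l + sum (λ j → f (punchIn l j))  ≈⟨ +-congˡ (sum-cong-≋ (λ j → f≈0 _ (punchInᵢ≢i l j))) ⟩
    f l + sum (replicate n 0#)         ≈⟨ +-congˡ (sum-replicate-zero n) ⟩
    f l + 0#                           ≈⟨ +-identityʳ _ ⟩
    f l                                ∎

  module _ {m} (α : Chain R (suc m)) (t : Vec (Fin (suc m)) m) where

    term≈0 : ∀ j → α (σ j t) ≈ 0# → term R α t j ≈ 0#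
    term≈0 j α≈0 with hasFixed? (σ j t)
    ... | yes _ = ≈-trans (*-congˡ α≈0) (zeroʳ _)
    ... | no _ = ≈-refl

    term≈0⇒≈0 : ∀ l → InM t l → term R α t l ≈ 0# → α (σ l t) ≈ 0#
    term≈0⇒≈0 l (_ , fixed) term≈0 with hasFixed? (σ l t)
    ... | yes _ = sgn*x≈0⇒x≈0 (toℕ l) term≈0
    ... | no no-fixed = ⊥-elim (no-fixed fixed)

    cycle-≈0-at-last : IsCycle R α → InF t → ∀ l → InM t l →
      (∀ j → j ≢ l → α (σ j t) ≈ 0#) → α (σ l t) ≈ 0#
    cycle-≈0-at-last (_ , closed) t∈F l l∈M α≈0 = term≈0⇒≈0 l l∈M (begin
      term R α t l ≈⟨ sum-single (term R α t) l (λ j j≢l → term≈0 j (α≈0 j j≢l)) ⟨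
      d R α t      ≈⟨ closed t t∈F ⟩
      0#           ∎)

lemma4p8 : ∀ {c ℓ : Level} (R : Ring c ℓ) (m : ℕ) → 3 ≤ m →
    (t : Vec (Fin (suc m)) m) → InF t →
    (l : Fin (suc m)) → InM t l →
    (∀ (i : Fin (suc m)) → InM t i → i ≢ l →
      ∃ λ (t′ : Vec (Fin (suc m)) m) → InFred R t′ × (t′ ⪯ σ i t)) →
    InFred R t
lemma4p8 R m _ t t∈F l l∈M reduced = t∈F , λ s s∈P t⪯s → s∈P , λ α cycle →
  let i , s≡σ = ⪯⇒≡σ t s (proj₁ s∈P) t⪯s
  in  subst (λ s → α s ≈ 0#) (sym s≡σ) (≈0-on-σ α cycle i)
  where
  open Ring R using (_≈_; 0#)

  ≈0-off-l : ∀ α → IsCycle R α → ∀ j → j ≢ l → α (σ j t) ≈ 0#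
  ≈0-off-l α cycle j j≢l with InP? (σ j t)
  ... | no σ∉P = proj₁ cycle (σ j t) σ∉P
  ... | yes σ∈P with t′ , (_ , t′-reduced) , t′⪯σ ← reduced j σ∈P j≢l
    = proj₂ (t′-reduced (σ j t) σ∈P t′⪯σ) α cycle

  ≈0-on-σ : ∀ α → IsCycle R α → ∀ i → α (σ i t) ≈ 0#
  ≈0-on-σ α cycle i with i ≟F l
  ... | yes refl = cycle-≈0-at-last R α t cycle t∈F l l∈M (≈0-off-l α cycle)
  ... | no i≢l = ≈0-off-l α cycle i i≢l
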